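{- Let $p\in\mathcal{P}_l$ be $n$-ary, $X\subseteq\{1,\dots,n\}$ and $i\in X$. Then $x_i$ is allocated in every predicate-less unfolding, with respect to $\mathcal{R}_l$, of $p_X(x_1,\dots,x_{n+\nu})$.
   Context: Separation Logic: formulas from $x\not\approx x'$, $x\approx x'$, points-to atoms, predicate atoms, $*$, $\vee$, $\exists$; an SID is a finite set of rules $p(x_1..x_n)\Leftarrow\pi$ with $\pi$ a quantifier-free separating conjunction of atoms. Unfolding: replace an atom $p(u_1..u_n)$ by $\pi[x_i/u_i]$ for a rule $p(x_1..x_n)\Leftarrow\pi$ (existential variables renamed fresh); an unfolding is the result of finitely many such steps; predicate-less means no predicate atoms remain. A variable $x$ is allocated by a symbolic heap if it contains equalities $x=v_1\approx v_2\approx\dots\approx v_k$ ($k\ge1$) and an atom $v_k\mapsto(\dots)$. $\mathcal{P}(\alpha)$: predicates reachable via rule bodies from those in $\alpha$. Standing setting: $\mathcal{R}$ is an SID with records of length $\kappa$ whose rules are progressing ($p(x_1..x_n)\Leftarrow x_1\mapsto(y_1..y_\kappa)*\rho$, no points-to in $\rho$); $\phi$ a formula and $\mathcal{P}_l=\mathcal{P}(\phi)$; $\mathbf{w}=(w_1..w_\nu)$, $\nu>0$, fixed variables not in $\mathcal{R}$; each rule of $\mathcal{R}$ has exactly $\mu$ existential variables; for $p\in\mathcal{P}_l$, in every rule $p(x_1..x_n)\Leftarrow\pi$ and every atom $q(x'_1..x'_m)$ in $\pi$, $x'_1\notin\{x_1..x_n\}$. Predicate $\mathsf{B}$ has the rule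 $\mathsf{B}(x)\Leftarrow x\mapsto(\bot,\dots,\bot)$ with $\kappa+\nu+\mu$ fields, included in $\mathcal{R}_l$. Decorations: for $n$-ary $p\in\mathcal{P}_l$ and $X\subseteq\{1..n\}$, $p_X$ is a fresh $(n+\nu)$-ary predicate; a decoration of a formula replaces each atom $q(y_1..y_m)$ by some $q_Y(y_1..y_m,\mathbf{w})$, $Y\subseteq\{1..m\}$. $\mathrm{Dec}(\mathcal{R})$ consists of the rules $p_X(x_1..x_n,\mathbf{w})\Leftarrow x_1\mapsto(y_1..y_\kappa,\mathbf{w},z_1..z_\mu)\sigma*\rho'*\mathop{*}_{i\in I}\mathsf{B}(z_i)$ with $p(x_1..x_n)\Leftarrow x_1\mapsto(y_1..y_\kappa)*\rho$ in $\mathcal{R}$, $X\subseteq\{1..n\}$, $\{z_1..z_\mu\}=(\mathrm{fv}(\rho)\cup\{y_1..y_\kappa\})\setminus\{x_1..x_n\}$, $\sigma$ a substitution with domain in $\{z_1..z_\mu\}$ and image in $\{x_1..x_n,w_1..w_\nu,z_1..z_\mu\}$, $\rho'$ a decoration of $\rho\sigma$, $I\subseteq\{1..\mu\}$ with $z_i\notin\mathrm{dom}(\sigma)$ for $i\in I$. For a formula $\alpha$, $x\in\mathrm{Alloc}(\alpha)$ iff $\alpha$ contains a points-to atom $x\mapsto(\dots)$ or a predicate atom $q_Y(x'_1..x'_{m+\nu})$ with $x'_i=x$ for some $i\in Y$. A rule $p_X(x_1..x_{n+\nu})\Leftarrow\pi$ of $\mathrm{Dec}(\mathcal{R})$ is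 well-defined iff $\{x_1\}\subseteq\mathrm{Alloc}(p_X(x_1..x_{n+\nu}))\subseteq\mathrm{Alloc}(\pi)$ and $\mathrm{fv}(\pi)\subseteq\mathrm{Alloc}(\pi)\cup\{x_1..x_{n+\nu}\}$. $\mathcal{R}_l$ is the set of well-defined rules of $\mathrm{Dec}(\mathcal{R})$. -}

module Defs where

open import Data.Nat using (ℕ; zero; suc; _+_)
open import Data.Fin using (Fin; _↑ˡ_)
open import Data.Fin.Subset using (Subset) renaming (_∈_ to _∈ˢ_)
open import Data.Bool using (true; false)
open import Data.List using (List; []; _∷_; _++_; map)
open import Data.List.Membership.Propositional using () renaming (_∈_ to _∈ᴸ_)
open import Data.List.Relation.Unary.All using (All)
open import Data.List.Relation.Unary.Any using (Any)
open import Data.List.Relation.Binary.Pointwise using (Pointwise)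
open import Data.Vec using (Vec; lookup) renaming ([] to []ᵛ; _∷_ to _∷ᵛ_; _++_ to _++ᵛ_; map to mapᵛ; toList to toListᵛ; replicate to replicateᵛ)
open import Data.Vec.Membership.Propositional using () renaming (_∈_ to _∈ⱽ_; _∉_ to _∉ⱽ_)
open import Data.Product using (Σ; _×_; _,_)
open import Data.Sum using (_⊎_)
open import Relation.Nullary using (¬_)
open import Relation.Binary.PropositionalEquality using (_≡_)
open import Relation.Binary.Construct.Closure.ReflexiveTransitive using (Star)
open import Function.Bundles using (_⇔_)

Distinct : ∀ {A : Set} {n} → Vec A n → Set
Distinct {n = n} v = ∀ (i j : Fin n) → lookup v i ≡ lookup v j → i ≡ j

data First {A : Set} : ∀ {n} → Vec A n → A → Set where
  first : ∀ {n x} {xs : Vec A n} → First (x ∷ᵛ xs) x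

-- Terms: record fields are variables (natural-number names) or ⊥ (nil)

data Term : Set where
  var : ℕ → Term
  nil : Term

module Syntax (P : Set) (ar : P → ℕ) where

  infix 6 _≈ₐ_ _≉ₐ_ _↦_

  data Atom : Set where
    _≈ₐ_ : ℕ → ℕ → Atom
    _≉ₐ_ : ℕ → ℕ → Atom
    _↦_  : ℕ → List Term → Atom
    call : (q : P) → Vec ℕ (ar q) → Atom

  -- a quantifier-free separating conjunction of atoms
  SymHeap : Set
  SymHeap = List Atom

  data Formula : Set where
    atom : Atom → Formula
    _∗_  : Formula → Formula → Formula
    _∨_  : Formula → Formula → Formula
    ex   : ℕ → Formula → Formula

  data FreeIn (v : ℕ) : Atom → Set where
    eqL  : ∀ {y} → FreeIn v (v ≈ₐ y)
    eqR  : ∀ {x} → FreeIn v (x ≈ₐ v)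
    neqL : ∀ {y} → FreeIn v (v ≉ₐ y)
    neqR : ∀ {x} → FreeIn v (x ≉ₐ v)
    ptoS : ∀ {ts} → FreeIn v (v ↦ ts)
    ptoF : ∀ {x ts} → var v ∈ᴸ ts → FreeIn v (x ↦ ts)
    callA : ∀ {q us} → v ∈ⱽ us → FreeIn v (call q us)

  FV : ℕ → SymHeap → Set
  FV v h = Any (FreeIn v) h

  data IsCall : Atom → Set where
    isCall : ∀ {q us} → IsCall (call q us)

  data IsPto : Atom → Set where
    isPto : ∀ {x ts} → IsPto (x ↦ ts)

  data CallsIn (q : P) : SymHeap → Set where
    here  : ∀ {us h} → CallsIn q (call q us ∷ h)
    there : ∀ {a h} → CallsIn q h → CallsIn q (a ∷ h)

  data OccursIn (q : P) : Formula → Set where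
    atomO : ∀ {us} → OccursIn q (atom (call q us))
    starL : ∀ {φ ψ} → OccursIn q φ → OccursIn q (φ ∗ ψ)
    starR : ∀ {φ ψ} → OccursIn q ψ → OccursIn q (φ ∗ ψ)
    orL   : ∀ {φ ψ} → OccursIn q φ → OccursIn q (φ ∨ ψ)
    orR   : ∀ {φ ψ} → OccursIn q ψ → OccursIn q (φ ∨ ψ)
    exO   : ∀ {x φ} → OccursIn q φ → OccursIn q (ex x φ)

  renameT : (ℕ → ℕ) → Term → Term
  renameT ρ (var x) = var (ρ x)
  renameT ρ nil     = nil

  renameA : (ℕ → ℕ) → Atom → Atom
  renameA ρ (x ≈ₐ y)    = ρ x ≈ₐ ρ y
  renameA ρ (x ≉ₐ y)    = ρ x ≉ₐ ρ y
  renameA ρ (x ↦ ts)    = ρ x ↦ map (renameT ρ) ts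
  renameA ρ (call q us) = call q (mapᵛ ρ us)

  record Rule : Set where
    constructor mkRule
    field
      head   : P
      params : Vec ℕ (ar head)
      body   : SymHeap
  open Rule public

  Existential : Rule → ℕ → Set
  Existential r v = FV v (body r) × v ∉ⱽ params r

  record Step (S : Rule → Set) (h h' : SymHeap) : Set where
    field
      r      : Rule
      r∈S    : S r
      u      : Vec ℕ (ar (head r))
      pre    : SymHeap
      post   : SymHeap
      ρ      : ℕ → ℕ
      split  : h ≡ pre ++ (call (head r) u ∷ post)
      ρ-par  : ∀ i → ρ (lookup (params r) i) ≡ lookup u i
      ρ-fresh : ∀ e → Existential r e → ¬ FV (ρ e) h
      ρ-inj  : ∀ e e' → Existential r e → Existential r e' → ρ e ≡ ρ e' → e ≡ e'
      result : h' ≡ pre ++ (map (renameA ρ) (body r) ++ post)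

  Unfolding : (Rule → Set) → SymHeap → SymHeap → Set
  Unfolding S = Star (Step S)

  PredicateLess : SymHeap → Set
  PredicateLess h = All (λ a → ¬ IsCall a) h

  data Allocated (h : SymHeap) : ℕ → Set where
    ptoAl : ∀ {x ts} → (x ↦ ts) ∈ᴸ h → Allocated h x
    eqAl  : ∀ {x y} → ((x ≈ₐ y) ∈ᴸ h ⊎ (y ≈ₐ x) ∈ᴸ h) → Allocated h y → Allocated h x

-- The standing setting: a progressing SID R with records of length κ,
-- every rule having exactly μ existential variables

module Setting (Pred : Set) (ar : Pred → ℕ) (κ μ : ℕ) where

  open Syntax Pred ar public

  -- a progressing rule  p(x₁..xₙ) ⇐ x₁ ↦ (y₁..y_κ) * ρ ,
  -- together with an enumeration z₁..z_μ of its existential variables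
  record ProgRule : Set where
    field
      pHead    : Pred
      pParams  : Vec ℕ (ar pHead)
      pParams-distinct : Distinct pParams
      x₁       : ℕ
      x₁-first : First pParams x₁
      ys       : Vec ℕ κ
      ρ        : SymHeap
      ρ-noPto  : All (λ a → ¬ IsPto a) ρ
      zs       : Vec ℕ μ
      zs-distinct : Distinct zs
      zs-spec  : ∀ v → (v ∈ⱽ zs) ⇔ ((FV v ρ ⊎ v ∈ⱽ ys) × v ∉ⱽ pParams)
  open ProgRule public

  toRule : ProgRule → Rule
  toRule r = mkRule (pHead r) (pParams r) ((x₁ r ↦ toListᵛ (mapᵛ var (ys r))) ∷ ρ r)

  data Reach (R : List ProgRule) (φ : Formula) : Pred → Set where
    base : ∀ {q} → OccursIn q φ → Reach R φ q
    step : ∀ {r q} → r ∈ᴸ R → Reach R φ (pHead r) → CallsIn q (body (toRule r)) → Reach R φ q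

  PlCondition : List ProgRule → Formula → Set
  PlCondition R φ = ∀ r → r ∈ᴸ R → Reach R φ (pHead r) →
    ∀ q (us : Vec ℕ (ar q)) → call q us ∈ᴸ ρ r → ∀ v → First us v → v ∉ⱽ pParams r

  NotInSID : ∀ {ν} → List ProgRule → Vec ℕ ν → Set
  NotInSID R w = ∀ r → r ∈ᴸ R → ∀ v → v ∈ⱽ w → ¬ FV v (body (toRule r)) × v ∉ⱽ pParams r

  data DPred : Set where
    dec : (p : Pred) → Subset (ar p) → DPred
    𝔹   : DPred

  module Decorated (ν : ℕ) (w : Vec ℕ ν) where

    dar : DPred → ℕ
    dar (dec p X) = ar p + ν
    dar 𝔹         = 1

    module D = Syntax DPred dar

    data Decorates : Atom → D.Atom → Set where
      decEq   : ∀ {x y} → Decorates (x ≈ₐ y) (x D.≈ₐ y)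
      decNeq  : ∀ {x y} → Decorates (x ≉ₐ y) (x D.≉ₐ y)
      decPto  : ∀ {x ts} → Decorates (x ↦ ts) (x D.↦ ts)
      decCall : ∀ {q us} (Y : Subset (ar q)) →
                Decorates (call q us) (D.call (dec q Y) (us ++ᵛ w))

    Decoration : SymHeap → D.SymHeap → Set
    Decoration = Pointwise Decorates

    BAtoms : ∀ {m} → Vec ℕ m → Subset m → D.SymHeap
    BAtoms []ᵛ []ᵛ = []
    BAtoms (z ∷ᵛ zs') (true ∷ᵛ I) = D.call 𝔹 (z ∷ᵛ []ᵛ) ∷ BAtoms zs' I
    BAtoms (z ∷ᵛ zs') (false ∷ᵛ I) = BAtoms zs' I

    record InDec (R : List ProgRule) (φ : Formula) (dr : D.Rule) : Set where
      field
        orig   : ProgRule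
        orig∈R : orig ∈ᴸ R
        inPl   : Reach R φ (pHead orig)
        X      : Subset (ar (pHead orig))
        σ      : ℕ → ℕ
        σ-dom  : ∀ v → v ∉ⱽ zs orig → σ v ≡ v
        σ-img  : ∀ v → v ∈ⱽ zs orig →
                 σ v ∈ⱽ pParams orig ⊎ σ v ∈ⱽ w ⊎ σ v ∈ⱽ zs orig
        ρ'     : D.SymHeap
        ρ'-dec : Decoration (map (renameA σ) (ρ orig)) ρ'
        I      : Subset μ
        I-dom  : ∀ i → i ∈ˢ I → σ (lookup (zs orig) i) ≡ lookup (zs orig) i
        shape  : dr ≡ D.mkRule (dec (pHead orig) X) (pParams orig ++ᵛ w)
                   ((x₁ orig D.↦ toListᵛ (mapᵛ var (mapᵛ σ (ys orig ++ᵛ (w ++ᵛ zs orig)))))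
                    ∷ (ρ' ++ BAtoms (zs orig) I))

    data AllocIn (x : ℕ) (α : D.SymHeap) : Set where
      allocPto  : ∀ {ts} → (x D.↦ ts) ∈ᴸ α → AllocIn x α
      allocCall : ∀ {q Y us} (i : Fin (ar q)) → D.call (dec q Y) us ∈ᴸ α →
                  i ∈ˢ Y → lookup us (i ↑ˡ ν) ≡ x → AllocIn x α
      allocB    : D.call 𝔹 (x ∷ᵛ []ᵛ) ∈ᴸ α → AllocIn x α

    WellDefined : D.Rule → Set
    WellDefined dr =
      (∀ x → First (D.params dr) x → AllocIn x (hd ∷ [])) ×
      (∀ x → AllocIn x (hd ∷ []) → AllocIn x (D.body dr)) ×
      (∀ x → D.FV x (D.body dr) → AllocIn x (D.body dr) ⊎ x ∈ⱽ D.params dr)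
      where hd = D.call (D.head dr) (D.params dr)

    BRule : D.Rule
    BRule = D.mkRule 𝔹 (0 ∷ᵛ []ᵛ) ((0 D.↦ toListᵛ (replicateᵛ (κ + ν + μ) nil)) ∷ [])

    Rl : List ProgRule → Formula → D.Rule → Set
    Rl R φ dr = (InDec R φ dr × WellDefined dr) ⊎ dr ≡ BRule

-- Alloc is an invariant of unfolding w.r.t. R_l. Well-definedness of a rule
-- says its body allocates everything its head allocates, and instantiating a
-- rule (renaming parameters to arguments) preserves this, so replacing an atom
-- by an instance of a body never loses an allocated variable. The head
-- p_X(x₁..x_{n+ν}) allocates x_i for i ∈ X, and in a predicate-less heap the
-- only source of Alloc is a points-to atom, which is allocation proper.
module Submission where

open import Defs
open import Data.Nat using (ℕ; _+_; _<_)
open import Data.Fin using (Fin; _↑ˡ_; zero)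
open import Data.Fin.Subset using (Subset; _∈_)
open import Data.List using (List; []; _∷_; map)
open import Data.List.Relation.Unary.Any using (here; there)
open import Data.List.Relation.Unary.All as All using ()
open import Data.List.Membership.Propositional using () renaming (_∈_ to _∈ᴸ_)
open import Data.List.Membership.Propositional.Properties using (∈-map⁺; ∈-++⁺ˡ; ∈-++⁺ʳ; ∈-++⁻)
open import Data.List.Relation.Binary.Subset.Propositional using (_⊆_)
open import Data.Vec using (Vec; lookup) renaming (_∷_ to _∷ᵛ_; [] to []ᵛ)
open import Data.Vec.Properties using (lookup-map)
open import Data.Product using (Σ; _×_; _,_)
open import Data.Sum using (inj₁; inj₂)
open import Data.Empty using (⊥-elim)
open import Relation.Binary.PropositionalEquality using (_≡_; refl; trans; cong; subst)
open import Relation.Binary.Construct.Closure.ReflexiveTransitive using (ε; _◅_)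

module AllocInvariant (Pred : Set) (ar : Pred → ℕ) (κ μ ν : ℕ) (w : Vec ℕ ν) where
  open Setting Pred ar κ μ using (𝔹)
  open Setting.Decorated Pred ar κ μ ν w

  AllocIn-resp-⊆ : ∀ {x α β} → α ⊆ β → AllocIn x α → AllocIn x β
  AllocIn-resp-⊆ α⊆β (allocPto m)          = allocPto (α⊆β m)
  AllocIn-resp-⊆ α⊆β (allocCall i m iY lk) = allocCall i (α⊆β m) iY lk
  AllocIn-resp-⊆ α⊆β (allocB m)            = allocB (α⊆β m)

  AllocIn-witness : ∀ {x α} → AllocIn x α → Σ D.Atom λ a → a ∈ᴸ α × AllocIn x (a ∷ [])
  AllocIn-witness (allocPto m)          = _ , m , allocPto (here refl)
  AllocIn-witness (allocCall i m iY lk) = _ , m , allocCall i (here refl) iY lk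
  AllocIn-witness (allocB m)            = _ , m , allocB (here refl)

  AllocIn-atom : ∀ {x a β} → a ∈ᴸ β → AllocIn x (a ∷ []) → AllocIn x β
  AllocIn-atom a∈β = AllocIn-resp-⊆ λ { (here refl) → a∈β }

  AllocIn-renameA : ∀ {x α} (ρ : ℕ → ℕ) → AllocIn x α → AllocIn (ρ x) (map (D.renameA ρ) α)
  AllocIn-renameA ρ (allocPto m) = allocPto (∈-map⁺ (D.renameA ρ) m)
  AllocIn-renameA ρ (allocCall {us = us} i m iY lk) =
    allocCall i (∈-map⁺ (D.renameA ρ) m) iY (trans (lookup-map (i ↑ˡ ν) ρ us) (cong ρ lk))
  AllocIn-renameA ρ (allocB m) = allocB (∈-map⁺ (D.renameA ρ) m)

  AllocMonotone : D.Rule → Set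
  AllocMonotone r = ∀ x → AllocIn x (D.call (D.head r) (D.params r) ∷ []) → AllocIn x (D.body r)

  BRule-allocMonotone : AllocMonotone BRule
  BRule-allocMonotone x (allocPto (here ()))
  BRule-allocMonotone x (allocCall i (here ()) iY lk)
  BRule-allocMonotone x (allocB (here refl)) = allocPto (here refl)

  Rl-allocMonotone : ∀ R φ r → Rl R φ r → AllocMonotone r
  Rl-allocMonotone R φ r (inj₁ (_ , (_ , head⊆body , _))) = head⊆body
  Rl-allocMonotone R φ r (inj₂ refl)                      = BRule-allocMonotone

  AllocIn-instantiate : ∀ {x} (r : D.Rule) (u : Vec ℕ (dar (D.head r))) (ρ : ℕ → ℕ) →
    (∀ i → ρ (lookup (D.params r) i) ≡ lookup u i) → AllocMonotone r →
    AllocIn x (D.call (D.head r) u ∷ []) → AllocIn x (map (D.renameA ρ) (D.body r))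
  AllocIn-instantiate r u ρ ρ-par mono (allocPto (here ()))
  AllocIn-instantiate r u ρ ρ-par mono (allocCall i (here refl) iY refl) =
    subst (λ y → AllocIn y _) (ρ-par (i ↑ˡ ν))
      (AllocIn-renameA ρ (mono _ (allocCall i (here refl) iY refl)))
  AllocIn-instantiate (D.mkRule 𝔹 (_ ∷ᵛ []ᵛ) _) (_ ∷ᵛ []ᵛ) ρ ρ-par mono (allocB (here refl)) =
    subst (λ y → AllocIn y _) (ρ-par zero)
      (AllocIn-renameA ρ (mono _ (allocB (here refl))))

  module _ {S : D.Rule → Set} (S-mono : ∀ r → S r → AllocMonotone r) where

    Step-AllocIn : ∀ {x h h'} → D.Step S h h' → AllocIn x h → AllocIn x h'
    Step-AllocIn record { r = r ; r∈S = r∈S ; u = u ; pre = pre ; ρ = ρ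
                        ; split = refl ; ρ-par = ρ-par ; result = refl } al
      with AllocIn-witness al
    ... | a , a∈h , alₐ with ∈-++⁻ pre a∈h
    ... | inj₁ a∈pre          = AllocIn-atom (∈-++⁺ˡ a∈pre) alₐ
    ... | inj₂ (there a∈post) = AllocIn-atom (∈-++⁺ʳ pre (∈-++⁺ʳ _ a∈post)) alₐ
    ... | inj₂ (here refl)    =
      AllocIn-resp-⊆ (λ b∈ → ∈-++⁺ʳ pre (∈-++⁺ˡ b∈))
        (AllocIn-instantiate r u ρ ρ-par (S-mono r r∈S) alₐ)

    Unfolding-AllocIn : ∀ {x h h'} → D.Unfolding S h h' → AllocIn x h → AllocIn x h'
    Unfolding-AllocIn ε          al = al
    Unfolding-AllocIn (st ◅ sts) al = Unfolding-AllocIn sts (Step-AllocIn st al)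

  PredicateLess-allocated : ∀ {x h} → D.PredicateLess h → AllocIn x h → D.Allocated h x
  PredicateLess-allocated pl (allocPto m)          = D.ptoAl m
  PredicateLess-allocated pl (allocCall i m iY lk) = ⊥-elim (All.lookup pl m D.isCall)
  PredicateLess-allocated pl (allocB m)            = ⊥-elim (All.lookup pl m D.isCall)

lemma7 : {Pred : Set} {ar : Pred → ℕ} {κ μ ν : ℕ}
    (R : List (Setting.ProgRule Pred ar κ μ))
    (φ : Setting.Formula Pred ar κ μ)
    (w : Vec ℕ ν) → 0 < ν → Distinct w →
    Setting.NotInSID Pred ar κ μ R w →
    Setting.PlCondition Pred ar κ μ R φ →
    (p : Pred) → Setting.Reach Pred ar κ μ R φ p →
    (X : Subset (ar p)) (i : Fin (ar p)) → i ∈ X →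
    (xs : Vec ℕ (ar p + ν)) → Distinct xs →
    (h : Syntax.SymHeap (Setting.DPred Pred ar κ μ) (Setting.Decorated.dar Pred ar κ μ ν w)) →
    Syntax.Unfolding (Setting.DPred Pred ar κ μ) (Setting.Decorated.dar Pred ar κ μ ν w)
      (Setting.Decorated.Rl Pred ar κ μ ν w R φ)
      (Syntax.call (Setting.dec p X) xs ∷ []) h →
    Syntax.PredicateLess (Setting.DPred Pred ar κ μ) (Setting.Decorated.dar Pred ar κ μ ν w) h →
    Syntax.Allocated (Setting.DPred Pred ar κ μ) (Setting.Decorated.dar Pred ar κ μ ν w) h
      (lookup xs (i ↑ˡ ν))
lemma7 {Pred} {ar} {κ} {μ} {ν} R φ w _ _ _ _ p _ X i i∈X xs _ h unf predicateLess =
  PredicateLess-allocated predicateLess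
    (Unfolding-AllocIn (Rl-allocMonotone R φ) unf
      (Setting.Decorated.allocCall i (here refl) i∈X refl))
  where open AllocInvariant Pred ar κ μ ν w
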